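{- Let $n,r,s\ge 1$ and $m\ge 0$ be integers, and let $u_n=Z(\mathrm{U}_{n,m}^{(r,s)})$ be the Hosoya index of the graph $\mathrm{U}_{n,m}^{(r,s)}$ described in the context; by convention $u_0=2$. Put $M=(m+1)^2+r+s$. Then for every $n\ge 1$, $$ \frac{u_n}{u_{n-1}}=x_n , $$ where $x_1,x_2,\dots$ are defined by $x_1=M-\frac{M}{2}$ and $x_{k+1}=M-\frac{rs}{x_k}$ for $k\ge 1$. In continued-fraction notation, $$ \frac{u_n}{u_{n-1}}=M-\cfrac{rs}{M-\cfrac{rs}{\ddots-\cfrac{rs}{M-\cfrac{M}{2}}}}, $$ with $M$ appearing $n$ times. Furthermore, for $n\ge 1$, $$ u_n=\left(\frac{M+\sqrt{M^2-4rs}}{2}\right)^n+\left(\frac{M-\sqrt{M^2-4rs}}{2}\right)^n . $$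
   Context: Graphs may have parallel edges. The Hosoya index $Z(G)$ of a finite multigraph $G$ is the number of matchings of $G$, that is, the number of sets of pairwise vertex-disjoint edges, including the empty set. Parallel edges are counted as distinct edges. The graph $\mathrm{U}_{n,m}^{(r,s)}$ is built as follows. Take a cycle on $2n$ vertices $v_1,\dots,v_{2n}$ (indices taken mod $2n$). For each $i$, join $v_{2i-1}$ and $v_{2i}$ by $r$ parallel edges, and join $v_{2i}$ and $v_{2i+1}$ by $s$ parallel edges. When $n=1$, this means $v_1$ and $v_2$ are joined by $r+s$ parallel edges. Finally, attach $m$ pendant vertices (leaves) to each $v_j$. For example, benzene $\mathrm{C}_6\mathrm{H}_6$ corresponds to $\mathrm{U}_{3,1}^{(2,1)}$. -}

module Defs where

open import Data.Nat as ℕ using (ℕ; zero; suc; _≡ᵇ_)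
open import Data.Bool using (if_then_else_)
open import Data.Integer using (+_)
open import Data.Rational as ℚ using (ℚ; 0ℚ; _÷_; ½; ≢-nonZero)
open import Data.Rational.Properties using () renaming (_≟_ to _≟ℚ_)
open import Data.List using (List; []; _∷_; _++_; map; concatMap; replicate; upTo; length; filter)
open import Data.List.Relation.Unary.AllPairs using (AllPairs; allPairs?)
open import Data.Product using (_×_; _,_)
open import Data.Sum using (_⊎_; inj₁; inj₂)
open import Data.Sum.Properties using () renaming (≡-dec to ⊎-≡-dec)
open import Data.Product.Properties using () renaming (≡-dec to ×-≡-dec)
open import Relation.Nullary using (¬_; Dec; yes; no)
open import Relation.Nullary.Decidable using (_×-dec_; ¬?)
open import Relation.Binary.PropositionalEquality using (_≡_)
open import Relation.Binary.Definitions using (DecidableEquality)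

-- Finite multigraphs, given by a vertex type with decidable equality
-- and a list of edges (each list entry is a distinct edge, so parallel
-- edges are repeated entries).

module Matchings {V : Set} (_≟_ : DecidableEquality V) where

  Edge : Set
  Edge = V × V

  Disjoint : Edge → Edge → Set
  Disjoint (a , b) (c , d) = ¬ a ≡ c × ¬ a ≡ d × ¬ b ≡ c × ¬ b ≡ d

  disjoint? : (e f : Edge) → Dec (Disjoint e f)
  disjoint? (a , b) (c , d) =
    ¬? (a ≟ c) ×-dec ¬? (a ≟ d) ×-dec ¬? (b ≟ c) ×-dec ¬? (b ≟ d)

  IsMatching : List Edge → Set
  IsMatching = AllPairs Disjoint

  isMatching? : (es : List Edge) → Dec (IsMatching es)
  isMatching? = allPairs? disjoint?

  -- all subsets of the edge list (edges identified by their position,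
  -- so parallel edges are distinct)
  subsets : List Edge → List (List Edge)
  subsets []       = [] ∷ []
  subsets (e ∷ es) = subsets es ++ map (e ∷_) (subsets es)

  hosoya : List Edge → ℕ
  hosoya es = length (filter isMatching? (subsets es))

-- The graph U_{n,m}^{(r,s)}.
-- Cycle vertex v_{j+1} (0 ≤ j < 2n) is  inj₁ j ;
-- the k-th leaf (0 ≤ k < m) attached to v_{j+1} is  inj₂ (j , k).

UVertex : Set
UVertex = ℕ ⊎ (ℕ × ℕ)

_≟V_ : DecidableEquality UVertex
_≟V_ = ⊎-≡-dec ℕ._≟_ (×-≡-dec ℕ._≟_ ℕ._≟_)

nextC : ℕ → ℕ → ℕ
nextC n j = if suc j ≡ᵇ (2 ℕ.* n) then 0 else suc j

cycleEdges : ℕ → ℕ → ℕ → List (UVertex × UVertex)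
cycleEdges n r s = concatMap block (upTo n)
  where
  block : ℕ → List (UVertex × UVertex)
  block i = replicate r (inj₁ (2 ℕ.* i) , inj₁ (suc (2 ℕ.* i)))
         ++ replicate s (inj₁ (suc (2 ℕ.* i)) , inj₁ (nextC n (suc (2 ℕ.* i))))

leafEdges : ℕ → ℕ → List (UVertex × UVertex)
leafEdges n m =
  concatMap (λ j → map (λ k → (inj₁ j , inj₂ (j , k))) (upTo m)) (upTo (2 ℕ.* n))

U : (n m r s : ℕ) → List (UVertex × UVertex)
U n m r s = cycleEdges n r s ++ leafEdges n m

open Matchings _≟V_ public using (hosoya; IsMatching; subsets)

u : (n m r s : ℕ) → ℕ
u zero    m r s = 2
u (suc k) m r s = hosoya (U (suc k) m r s)

ℕ→ℚ : ℕ → ℚ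
ℕ→ℚ k = + k ℚ./ 1

-- division p / q ; total (returns 0 when q = 0), only ever used with q ≠ 0
_/ℚ_ : ℚ → ℚ → ℚ
p /ℚ q with q ≟ℚ 0ℚ
... | yes _  = 0ℚ
... | no q≢0 = _÷_ p q {{≢-nonZero q≢0}}

Mval : (m r s : ℕ) → ℚ
Mval m r s = ℕ→ℚ ((suc m) ℕ.* (suc m) ℕ.+ r ℕ.+ s)

-- x_1 = M - M/2 ,  x_{k+1} = M - rs / x_k   (x k m r s is x_{k+1})
x : (k m r s : ℕ) → ℚ
x zero    m r s = Mval m r s ℚ.- (Mval m r s /ℚ ℕ→ℚ 2)
x (suc k) m r s = Mval m r s ℚ.- (ℕ→ℚ (r ℕ.* s) /ℚ x k m r s)

-- Formal quadratic extension ℚ[t]/(t² - D): the pair (a , b) stands for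
-- a + b·√D.

module QuadExt (D : ℚ) where
  Q√ : Set
  Q√ = ℚ × ℚ

  _+√_ : Q√ → Q√ → Q√
  (a , b) +√ (c , d) = (a ℚ.+ c , b ℚ.+ d)

  _*√_ : Q√ → Q√ → Q√
  (a , b) *√ (c , d) = (a ℚ.* c ℚ.+ b ℚ.* d ℚ.* D , a ℚ.* d ℚ.+ b ℚ.* c)

  _^√_ : Q√ → ℕ → Q√
  z ^√ zero  = (ℚ.1ℚ , 0ℚ)
  z ^√ suc k = z *√ (z ^√ k)

closedForm : (n m r s : ℕ) → ℚ × ℚ
closedForm n m r s = (α ^√ n) +√ (β ^√ n)
  where
  M = Mval m r s
  D = M ℚ.* M ℚ.- ℕ→ℚ (4 ℕ.* r ℕ.* s)
  open QuadExt D
  α = (M ℚ.* ½ , ½)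
  β = (M ℚ.* ½ , ℚ.- ½)

-- Counting the matchings edge by edge while recording the covered vertices, the m leaves
-- of a cycle vertex contribute a factor m + 1 when that vertex is left uncovered, and 1
-- otherwise. The remaining weighted count over the cycle is computed block by block (a
-- block being the r edges v_{2i+1} v_{2i+2} followed by the s edges v_{2i+2} v_{2i+3}) with
-- a 2 × 2 transfer matrix of trace M and determinant rs. By Cayley–Hamilton,
-- u_{k+2} = M u_{k+1} - rs u_k, also for k = 0 with u_0 = 2, so u is the Lucas sequence of
-- X² - M X + rs: u_n is the sum of the n-th powers of its roots, and dividing the
-- recurrence by u_{k+1} gives u_{k+2} / u_{k+1} = M - rs / (u_{k+1} / u_k).
module Submission where

open import Defs hiding (hosoya; IsMatching; subsets)
open import Data.Nat using (ℕ; suc; _≤_; _∸_)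
open import Data.Rational using (0ℚ)
open import Data.Product using (_×_; _,_)
open import Relation.Binary.PropositionalEquality using (_≡_; refl)

module MatchingCount where

  open import Data.Bool using (Bool; true; false; _∨_; if_then_else_; T)
  open import Data.Bool.Properties using (∨-zeroʳ; ∨-identityʳ; T-≡)
  import Data.Bool.Properties as Bool
  open import Data.List using (List; []; _∷_; _++_; map; length; filter; replicate; upTo; applyUpTo; concatMap)
  open import Data.List.Properties
    using (length-++; ++-identityʳ; filter-++; filter-none; filter-≐; length-upTo; upTo-∷ʳ; map-++; map-cong-local)
  open import Data.List.Relation.Unary.All as All using (All; []; _∷_; all?)
  open import Data.List.Relation.Unary.All.Properties using (replicate⁺; map⁺)
  open import Data.List.Relation.Unary.AllPairs using (_∷_)
  open import Data.List.Relation.Unary.Unique.Propositional using (Unique)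
  open import Data.List.Relation.Unary.Unique.Propositional.Properties using (upTo⁺)
  open import Data.Nat using (zero; _+_; _*_; _<_; _≡ᵇ_; s≤s; z≤n)
  open import Data.Nat.ListAction using (product)
  open import Data.Nat.ListAction.Properties using (product-++)
  open import Data.Nat.Properties
  open import Data.Nat.Tactic.RingSolver using (solve-∀)
  open import Data.Product using (proj₁; proj₂)
  open import Data.Sum using (_⊎_; inj₁; inj₂)
  open import Data.Sum.Properties using (inj₁-injective; inj₂-injective)
  open import Function using (const; id; _⇔_; mk⇔; Equivalence)
  open import Relation.Binary.Definitions using (DecidableEquality)
  open import Relation.Binary.PropositionalEquality
    using (_≢_; refl; sym; trans; cong; cong₂; subst; ≢-sym; module ≡-Reasoning)
  open import Relation.Nullary using (¬_; no; does; contradiction)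
  open import Relation.Nullary.Decidable using (_×-dec_; dec-true; dec-false)
  open import Relation.Unary using (Decidable)

  ∨-≡-false⁻ : ∀ x {y} → x ∨ y ≡ false → x ≡ false × y ≡ false
  ∨-≡-false⁻ false y≡false = refl , y≡false

  ∨-≡-false⁺ : ∀ {x y} → x ≡ false → y ≡ false → x ∨ y ≡ false
  ∨-≡-false⁺ refl refl = refl

  length-filter-map : ∀ {A B : Set} {P : B → Set} (P? : Decidable P) (f : A → B) xs →
    length (filter P? (map f xs)) ≡ length (filter (λ x → P? (f x)) xs)
  length-filter-map P? f [] = refl
  length-filter-map P? f (x ∷ xs) with does (P? (f x))
  ... | true  = cong suc (length-filter-map P? f xs)
  ... | false = length-filter-map P? f xs

  module BlockedMatchingSum {V : Set} (_≟_ : DecidableEquality V) where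

    open Matchings _≟_ public using (Edge)
    open Matchings _≟_ using (Disjoint; IsMatching; isMatching?; subsets; hosoya)

    Blocked : Set
    Blocked = V → Bool

    unblocked : Blocked
    unblocked _ = false

    _⊕_ : Blocked → Edge → Blocked
    (B ⊕ (a , b)) v = B v ∨ does (v ≟ a) ∨ does (v ≟ b)

    hits : Blocked → Edge → Bool
    hits B (a , b) = B a ∨ B b

    -- the sum, over the matchings S ⊆ es avoiding the blocked vertices, of k (B ⊕ S)
    matchingSum : Blocked → List Edge → (Blocked → ℕ) → ℕ
    matchingSum B []       k = k B
    matchingSum B (e ∷ es) k =
      matchingSum B es k + (if hits B e then 0 else matchingSum (B ⊕ e) es k)

    ⊕-blocks₁ : ∀ B a b → (B ⊕ (a , b)) a ≡ true
    ⊕-blocks₁ B a b rewrite dec-true (a ≟ a) refl = ∨-zeroʳ (B a)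

    ⊕-blocks₂ : ∀ B a b → (B ⊕ (a , b)) b ≡ true
    ⊕-blocks₂ B a b rewrite dec-true (b ≟ b) refl | ∨-zeroʳ (does (b ≟ a)) = ∨-zeroʳ (B b)

    ⊕-elsewhere : ∀ B a b {v} → v ≢ a → v ≢ b → (B ⊕ (a , b)) v ≡ B v
    ⊕-elsewhere B a b {v} v≢a v≢b
      rewrite dec-false (v ≟ a) v≢a | dec-false (v ≟ b) v≢b = ∨-identityʳ (B v)

    ⊕-free⁻ : ∀ B a b v → (B ⊕ (a , b)) v ≡ false → B v ≡ false × v ≢ a × v ≢ b
    ⊕-free⁻ B a b v free with B v | v ≟ a | v ≟ b
    ⊕-free⁻ B a b v refl | false | no v≢a | no v≢b = refl , v≢a , v≢b

    hits-⊕ : ∀ B a b e → hits (B ⊕ (a , b)) e ≡ false ⇔ (Disjoint (a , b) e × hits B e ≡ false)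
    hits-⊕ B a b (c , d) = mk⇔ to from
      where
      to : hits (B ⊕ (a , b)) (c , d) ≡ false → Disjoint (a , b) (c , d) × hits B (c , d) ≡ false
      to h with ∨-≡-false⁻ ((B ⊕ (a , b)) c) h
      ... | hc , hd with ⊕-free⁻ B a b c hc | ⊕-free⁻ B a b d hd
      ... | Bc , c≢a , c≢b | Bd , d≢a , d≢b =
        (≢-sym c≢a , ≢-sym d≢a , ≢-sym c≢b , ≢-sym d≢b) , ∨-≡-false⁺ Bc Bd
      from : Disjoint (a , b) (c , d) × hits B (c , d) ≡ false → hits (B ⊕ (a , b)) (c , d) ≡ false
      from ((a≢c , a≢d , b≢c , b≢d) , h) with ∨-≡-false⁻ (B c) h
      ... | Bc , Bd = ∨-≡-false⁺
        (trans (⊕-elsewhere B a b (≢-sym a≢c) (≢-sym b≢c)) Bc)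
        (trans (⊕-elsewhere B a b (≢-sym a≢d) (≢-sym b≢d)) Bd)

    Avoids : Blocked → List Edge → Set
    Avoids B = All (λ e → hits B e ≡ false)

    AvoidingMatching : Blocked → List Edge → Set
    AvoidingMatching B S = IsMatching S × Avoids B S

    avoidingMatching? : ∀ B → Decidable (AvoidingMatching B)
    avoidingMatching? B S = isMatching? S ×-dec all? (λ e → hits B e Bool.≟ false) S

    avoidingMatching-∷ : ∀ B e S → hits B e ≡ false →
      AvoidingMatching B (e ∷ S) ⇔ AvoidingMatching (B ⊕ e) S
    avoidingMatching-∷ B (a , b) S free = mk⇔
      (λ { (disj ∷ S-matching , _ ∷ avoids) →
             S-matching , All.map (Equivalence.from (hits-⊕ B a b _)) (All.zip (disj , avoids)) })
      (λ { (S-matching , avoids) →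
             let disj , avoids′ = All.unzip (All.map (Equivalence.to (hits-⊕ B a b _)) avoids)
             in disj ∷ S-matching , free ∷ avoids′ })

    avoidingMatching-hit : ∀ B e S → hits B e ≡ true → ¬ AvoidingMatching B (e ∷ S)
    avoidingMatching-hit B e S hit (_ , free ∷ _) with () ← trans (sym hit) free

    countAvoiding : Blocked → List (List Edge) → ℕ
    countAvoiding B Ss = length (filter (avoidingMatching? B) Ss)

    countAvoiding-++ : ∀ B Ss Ts → countAvoiding B (Ss ++ Ts) ≡ countAvoiding B Ss + countAvoiding B Ts
    countAvoiding-++ B Ss Ts =
      trans (cong length (filter-++ (avoidingMatching? B) Ss Ts)) (length-++ (filter (avoidingMatching? B) Ss))

    countAvoiding≡matchingSum : ∀ B es → countAvoiding B (subsets es) ≡ matchingSum B es (const 1)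
    countAvoiding≡matchingSum B []       = refl
    countAvoiding≡matchingSum B (e ∷ es) = begin
      countAvoiding B (subsets es ++ map (e ∷_) (subsets es))
        ≡⟨ countAvoiding-++ B (subsets es) _ ⟩
      countAvoiding B (subsets es) + countAvoiding B (map (e ∷_) (subsets es))
        ≡⟨ cong₂ _+_ (countAvoiding≡matchingSum B es)
                     (trans (length-filter-map (avoidingMatching? B) (e ∷_) (subsets es))
                            (extensions (hits B e) refl)) ⟩
      matchingSum B (e ∷ es) (const 1) ∎
      where
      open ≡-Reasoning
      extends? : Decidable (λ S → AvoidingMatching B (e ∷ S))
      extends? S = avoidingMatching? B (e ∷ S)
      extensions : ∀ h → hits B e ≡ h →
        length (filter extends? (subsets es)) ≡ (if h then 0 else matchingSum (B ⊕ e) es (const 1))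
      extensions true  hit  = cong length
        (filter-none extends? (All.universal (λ S → avoidingMatching-hit B e S hit) (subsets es)))
      extensions false free = trans
        (cong length (filter-≐ extends? (avoidingMatching? (B ⊕ e))
          ((λ {S} → Equivalence.to (avoidingMatching-∷ B e S free)) ,
           (λ {S} → Equivalence.from (avoidingMatching-∷ B e S free))) (subsets es)))
        (countAvoiding≡matchingSum (B ⊕ e) es)

    hosoya≡matchingSum : ∀ es → hosoya es ≡ matchingSum unblocked es (const 1)
    hosoya≡matchingSum es = trans
      (cong length (filter-≐ isMatching? (avoidingMatching? unblocked)
        ((λ {S} matching → matching , All.universal (λ _ → refl) S) , proj₁) (subsets es)))
      (countAvoiding≡matchingSum unblocked es)

    matchingSum-++ : ∀ B xs ys k →
      matchingSum B (xs ++ ys) k ≡ matchingSum B xs (λ B′ → matchingSum B′ ys k)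
    matchingSum-++ B []       ys k = refl
    matchingSum-++ B (e ∷ xs) ys k = cong₂ _+_
      (matchingSum-++ B xs ys k) (cong (if hits B e then 0 else_) (matchingSum-++ (B ⊕ e) xs ys k))

    hits-⊕-self : ∀ B e → hits (B ⊕ e) e ≡ true
    hits-⊕-self B (a , b) rewrite ⊕-blocks₁ B a b = refl

    matchingSum-hit : ∀ B xs ys k → All (λ e → hits B e ≡ true) xs →
      matchingSum B (xs ++ ys) k ≡ matchingSum B ys k
    matchingSum-hit B []       ys k []              = refl
    matchingSum-hit B (e ∷ xs) ys k (hit ∷ all-hit) rewrite hit =
      trans (+-identityʳ _) (matchingSum-hit B xs ys k all-hit)

    matchingSum-parallel : ∀ B e j ys k → matchingSum B (replicate j e ++ ys) k
      ≡ matchingSum B ys k + (if hits B e then 0 else j * matchingSum (B ⊕ e) ys k)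
    matchingSum-parallel B e zero ys k with hits B e
    ... | true  = sym (+-identityʳ _)
    ... | false = sym (+-identityʳ _)
    matchingSum-parallel B e (suc j) ys k
      rewrite matchingSum-parallel B e j ys k
            | matchingSum-hit (B ⊕ e) (replicate j e) ys k (replicate⁺ j (hits-⊕-self B e))
      with hits B e
    ... | true  = +-identityʳ _
    ... | false = trans (+-assoc (matchingSum B ys k) _ _) (cong (matchingSum B ys k +_) (+-comm (j * _) _))

    matchingSum-path : ∀ B a b c r s k →
      matchingSum B (replicate r (a , b) ++ replicate s (b , c)) k
        ≡ k B + (if hits B (b , c) then 0 else s * k (B ⊕ (b , c)))
              + (if hits B (a , b) then 0 else r * k (B ⊕ (a , b)))
    matchingSum-path B a b c r s k = begin
      matchingSum B (replicate r (a , b) ++ replicate s (b , c)) k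
        ≡⟨ cong (λ es → matchingSum B (replicate r (a , b) ++ es) k) (sym (++-identityʳ _)) ⟩
      matchingSum B (replicate r (a , b) ++ replicate s (b , c) ++ []) k
        ≡⟨ matchingSum-parallel B (a , b) r (replicate s (b , c) ++ []) k ⟩
      along B + (if hits B (a , b) then 0 else r * along (B ⊕ (a , b)))
        ≡⟨ cong₂ _+_ (matchingSum-parallel B (b , c) s [] k)
                     (cong (λ n → if hits B (a , b) then 0 else r * n)
                           (matchingSum-hit (B ⊕ (a , b)) (replicate s (b , c)) [] k
                             (replicate⁺ s (cong (_∨ (B ⊕ (a , b)) c) (⊕-blocks₂ B a b))))) ⟩
      k B + (if hits B (b , c) then 0 else s * k (B ⊕ (b , c)))
          + (if hits B (a , b) then 0 else r * k (B ⊕ (a , b))) ∎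
      where
      open ≡-Reasoning
      along : Blocked → ℕ
      along B′ = matchingSum B′ (replicate s (b , c) ++ []) k

    matchingSum-positive : ∀ B es → 1 ≤ matchingSum B es (const 1)
    matchingSum-positive B []       = ≤-refl
    matchingSum-positive B (e ∷ es) = ≤-trans (matchingSum-positive B es) (m≤m+n _ _)

  open BlockedMatchingSum _≟V_

  leafChoices : ℕ → Bool → ℕ
  leafChoices W false = W
  leafChoices W true  = 1

  leafEdge : ℕ → ℕ → Edge
  leafEdge j k = (inj₁ j , inj₂ (j , k))

  leavesAt : ℕ → ℕ → List Edge
  leavesAt m j = map (leafEdge j) (upTo m)

  leafProduct : ℕ → Blocked → List ℕ → ℕ
  leafProduct W B js = product (map (λ j → leafChoices W (B (inj₁ j))) js)

  matchingSum-leavesAt : ∀ B j ks R → B (inj₁ j) ≡ false → (∀ k → B (inj₂ (j , k)) ≡ false) →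
    (∀ k → matchingSum (B ⊕ leafEdge j k) R (const 1) ≡ matchingSum B R (const 1)) →
    matchingSum B (map (leafEdge j) ks ++ R) (const 1) ≡ suc (length ks) * matchingSum B R (const 1)
  matchingSum-leavesAt B j []       R free leaves-free taken = sym (+-identityʳ _)
  matchingSum-leavesAt B j (k ∷ ks) R free leaves-free taken
    rewrite free | leaves-free k
          | matchingSum-leavesAt B j ks R free leaves-free taken
          | matchingSum-hit (B ⊕ leafEdge j k) (map (leafEdge j) ks) R (const 1)
              (map⁺ (All.universal (λ k′ → cong (_∨ (B ⊕ leafEdge j k) (inj₂ (j , k′)))
                                                (⊕-blocks₁ B (inj₁ j) (inj₂ (j , k)))) ks))
          | taken k
    = +-comm (suc (length ks) * matchingSum B R (const 1)) _

  matchingSum-leaves : ∀ m B js → Unique js → All (λ j → ∀ k → B (inj₂ (j , k)) ≡ false) js →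
    matchingSum B (concatMap (leavesAt m) js) (const 1) ≡ leafProduct (suc m) B js
  matchingSum-leaves m B []       _              _                   = refl
  matchingSum-leaves m B (j ∷ js) (j∉js ∷ unique) (leaves-free ∷ rest) with B (inj₁ j) in Bj
  ... | true = trans
    (matchingSum-hit B (leavesAt m j) _ (const 1)
      (map⁺ (All.universal (λ k → cong (_∨ B (inj₂ (j , k))) Bj) (upTo m))))
    (trans (matchingSum-leaves m B js unique rest) (sym (*-identityˡ _)))
  ... | false = trans
    (matchingSum-leavesAt B j (upTo m) _ Bj leaves-free λ k →
       trans (matchingSum-leaves m (B ⊕ leafEdge j k) js unique (rest-free k))
             (trans (product-⊕ k) (sym (matchingSum-leaves m B js unique rest))))
    (cong₂ _*_ (cong suc (length-upTo m)) (matchingSum-leaves m B js unique rest))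
    where
    rest-free : ∀ k → All (λ j′ → ∀ k′ → (B ⊕ leafEdge j k) (inj₂ (j′ , k′)) ≡ false) js
    rest-free k = All.zipWith (λ (j≢j′ , free) k′ → trans
      (⊕-elsewhere B (inj₁ j) (inj₂ (j , k)) (λ ()) (λ eq → j≢j′ (sym (cong proj₁ (inj₂-injective eq)))))
      (free k′))
      (j∉js , rest)
    product-⊕ : ∀ k → leafProduct (suc m) (B ⊕ leafEdge j k) js ≡ leafProduct (suc m) B js
    product-⊕ k = cong product (map-cong-local (All.map (λ j≢j′ → cong (leafChoices (suc m))
      (⊕-elsewhere B (inj₁ j) (inj₂ (j , k)) (λ eq → j≢j′ (sym (inj₁-injective eq))) (λ ()))) j∉js))

  leafPrefix : ℕ → Blocked → ℕ → ℕ
  leafPrefix W B zero    = 1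
  leafPrefix W B (suc j) = leafPrefix W B j * leafChoices W (B (inj₁ (suc j)))

  leafProduct-upTo : ∀ W B N →
    leafProduct W B (upTo (suc N)) ≡ leafChoices W (B (inj₁ 0)) * leafPrefix W B N
  leafProduct-upTo W B zero    = refl
  leafProduct-upTo W B (suc N) = begin
    leafProduct W B (upTo (suc (suc N)))
      ≡⟨ cong (leafProduct W B) (sym (upTo-∷ʳ (suc N))) ⟩
    product (map f (upTo (suc N) ++ suc N ∷ []))
      ≡⟨ cong product (map-++ f (upTo (suc N)) _) ⟩
    product (map f (upTo (suc N)) ++ f (suc N) ∷ [])
      ≡⟨ product-++ (map f (upTo (suc N))) _ ⟩
    leafProduct W B (upTo (suc N)) * (f (suc N) * 1)
      ≡⟨ cong₂ _*_ (leafProduct-upTo W B N) (*-identityʳ _) ⟩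
    f 0 * leafPrefix W B N * f (suc N)
      ≡⟨ *-assoc (f 0) _ _ ⟩
    f 0 * leafPrefix W B (suc N) ∎
    where
    open ≡-Reasoning
    f : ℕ → ℕ
    f j = leafChoices W (B (inj₁ j))

  nextC-last : ∀ {n j} → suc j ≡ 2 * n → nextC n j ≡ 0
  nextC-last {n} j+1≡2n rewrite j+1≡2n | Equivalence.to T-≡ (≡⇒≡ᵇ (2 * n) (2 * n) refl) = refl

  nextC-succ : ∀ {n j} → suc j < 2 * n → nextC n j ≡ suc j
  nextC-succ {n} {j} j+1<2n with suc j ≡ᵇ 2 * n in eq
  ... | true  = contradiction (≡ᵇ⇒≡ (suc j) (2 * n) (subst T (sym eq) _)) (<⇒≢ j+1<2n)
  ... | false = refl

  module HosoyaU (m r s : ℕ) where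

    W M : ℕ
    W = suc m
    M = W * W + r + s

    leafCount : ℕ → Blocked → ℕ
    leafCount n B = matchingSum B (leafEdges n m) (const 1)

    LeavesFree : Blocked → Set
    LeavesFree B = ∀ q → B (inj₂ q) ≡ false

    leafCount-prefix : ∀ n N B → 2 * n ≡ suc N → LeavesFree B →
      leafCount n B ≡ leafChoices W (B (inj₁ 0)) * leafPrefix W B N
    leafCount-prefix n N B 2n≡N+1 free = begin
      leafCount n B
        ≡⟨ matchingSum-leaves m B (upTo (2 * n)) (upTo⁺ (2 * n)) (All.universal (λ j k → free (j , k)) _) ⟩
      leafProduct W B (upTo (2 * n))
        ≡⟨ cong (λ L → leafProduct W B (upTo L)) 2n≡N+1 ⟩
      leafProduct W B (upTo (suc N))
        ≡⟨ leafProduct-upTo W B N ⟩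
      leafChoices W (B (inj₁ 0)) * leafPrefix W B N ∎
      where open ≡-Reasoning

    inj₁-≢ : ∀ {i j} → i < j → _≢_ {A = UVertex} (inj₁ i) (inj₁ j)
    inj₁-≢ i<j eq = <⇒≢ i<j (inj₁-injective eq)

    Outside : ℕ → ℕ → Set
    Outside p a = a ≡ 0 ⊎ p < a

    leafPrefix-⊕ : ∀ B p {a b} → Outside p a → Outside p b →
      leafPrefix W (B ⊕ (inj₁ a , inj₁ b)) p ≡ leafPrefix W B p
    leafPrefix-⊕ B zero    _     _     = refl
    leafPrefix-⊕ B (suc p) out-a out-b = cong₂ _*_
      (leafPrefix-⊕ B p (shrink out-a) (shrink out-b))
      (cong (leafChoices W) (⊕-elsewhere B _ _ (apart out-a) (apart out-b)))
      where
      shrink : ∀ {a} → Outside (suc p) a → Outside p a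
      shrink (inj₁ a≡0)   = inj₁ a≡0
      shrink (inj₂ p+1<a) = inj₂ (<-trans (n<1+n p) p+1<a)
      apart : ∀ {a} → Outside (suc p) a → inj₁ (suc p) ≢ inj₁ a
      apart (inj₁ refl)   ()
      apart (inj₂ p+1<a) eq = <⇒≢ p+1<a (inj₁-injective eq)

    Frontier : ℕ → Blocked → Set
    Frontier f B = LeavesFree B × (∀ j → f < j → B (inj₁ j) ≡ false)

    frontier-mono : ∀ {f f′ B} → f ≤ f′ → Frontier f B → Frontier f′ B
    frontier-mono f≤f′ (leaves , beyond) = leaves , λ j f′<j → beyond j (≤-<-trans f≤f′ f′<j)

    frontier-⊕ : ∀ {f a b B} → a ≤ f → b ≤ f → Frontier f B → Frontier f (B ⊕ (inj₁ a , inj₁ b))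
    frontier-⊕ {a = a} {b} {B} a≤f b≤f (leaves , beyond) =
      (λ q → trans (⊕-elsewhere B (inj₁ a) (inj₁ b) (λ ()) (λ ())) (leaves q)) ,
      (λ j f<j → trans (⊕-elsewhere B (inj₁ a) (inj₁ b) (apart a≤f f<j) (apart b≤f f<j)) (beyond j f<j))
      where
      apart : ∀ {a f j} → a ≤ f → f < j → inj₁ j ≢ inj₁ a
      apart a≤f f<j eq = <⇒≢ (≤-<-trans a≤f f<j) (sym (inj₁-injective eq))

    -- A state (z₀ , z₁) is the weighted number of ways to complete the count beyond the
    -- current frontier vertex, when that vertex is still free (z₀) or already matched (z₁);
    -- `start b` is the state at v_{2n+1} = v₁, where b says whether the first block matched v₁.
    transfer : ℕ × ℕ → ℕ × ℕ
    transfer (z₀ , z₁) = ((W * W + r) * z₀ + s * W * z₁ , W * z₀ + s * z₁)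

    transfers : ℕ → ℕ × ℕ → ℕ × ℕ
    transfers zero    z = z
    transfers (suc k) z = transfer (transfers k z)

    start : Bool → ℕ × ℕ
    start b = leafChoices W b , (if b then 0 else 1)

    select : Bool → ℕ × ℕ → ℕ
    select false = proj₁
    select true  = proj₂

    block-transfer : ∀ B (A Bv C : UVertex) (G : Blocked → ℕ) P (z : ℕ × ℕ) → B Bv ≡ false →
      G B ≡ P * leafChoices W (B A) * W * proj₁ z →
      (B C ≡ false → G (B ⊕ (Bv , C)) ≡ P * leafChoices W (B A) * 1 * proj₂ z) →
      (B C ≡ true → proj₂ z ≡ 0) →
      (B A ≡ false → G (B ⊕ (A , Bv)) ≡ P * 1 * 1 * proj₁ z) →
      matchingSum B (replicate r (A , Bv) ++ replicate s (Bv , C)) G ≡ P * select (B A) (transfer z)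
    block-transfer B A Bv C G P (z₀ , z₁) Bv-free none via-s C-taken via-r
      rewrite matchingSum-path B A Bv C r s G | Bv-free | none
      with B A | B C
    ... | false | false rewrite via-s refl | via-r refl = free-free P W r s z₀ z₁
      where
      free-free : ∀ P W r s z₀ z₁ → P * W * W * z₀ + s * (P * W * 1 * z₁) + r * (P * 1 * 1 * z₀)
                                     ≡ P * ((W * W + r) * z₀ + s * W * z₁)
      free-free = solve-∀
    ... | false | true  rewrite C-taken refl | via-r refl = free-taken P W r s z₀
      where
      free-taken : ∀ P W r s z₀ → P * W * W * z₀ + 0 + r * (P * 1 * 1 * z₀)
                                     ≡ P * ((W * W + r) * z₀ + s * W * 0)
      free-taken = solve-∀
    ... | true  | false rewrite via-s refl = taken-free P W s z₀ z₁
      where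
      taken-free : ∀ P W s z₀ z₁ → P * 1 * W * z₀ + s * (P * 1 * 1 * z₁) + 0 ≡ P * (W * z₀ + s * z₁)
      taken-free = solve-∀
    ... | true  | true  rewrite C-taken refl = taken-taken P W s z₀
      where
      taken-taken : ∀ P W s z₀ → P * 1 * W * z₀ + 0 + 0 ≡ P * (W * z₀ + s * 0)
      taken-taken = solve-∀

    blockAt : ℕ → ℕ → List Edge
    blockAt n a = replicate r (inj₁ a , inj₁ (suc a)) ++ replicate s (inj₁ (suc a) , inj₁ (nextC n (suc a)))

    blockAt-next : ∀ {n a c} → nextC n (suc a) ≡ c →
      blockAt n a ≡ replicate r (inj₁ a , inj₁ (suc a)) ++ replicate s (inj₁ (suc a) , inj₁ c)
    blockAt-next refl = refl

    blocksFrom : ℕ → ℕ → ℕ → List Edge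
    blocksFrom n a zero    = []
    blocksFrom n a (suc k) = blockAt n a ++ blocksFrom n (suc (suc a)) k

    cycleEdges-blocks : ∀ n → cycleEdges n r s ≡ blocksFrom n 0 n
    cycleEdges-blocks n = blocks id 0 n (λ _ → refl)
      where
      blocks : ∀ f a k → (∀ j → 2 * f j ≡ a + 2 * j) →
        concatMap (λ i → blockAt n (2 * i)) (applyUpTo f k) ≡ blocksFrom n a k
      blocks f a zero    _ = refl
      blocks f a (suc k) h = cong₂ _++_
        (cong (blockAt n) (trans (h 0) (+-identityʳ a)))
        (blocks (λ j → f (suc j)) (suc (suc a)) k λ j → trans (h (suc j)) (shift a j))
        where
        shift : ∀ a j → a + 2 * suc j ≡ suc (suc a) + 2 * j
        shift = solve-∀

    lastBlock-transfer : ∀ n p B → 2 * n ≡ suc p + 2 → Frontier (suc p) B →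
      matchingSum B (blockAt n (suc p)) (leafCount n)
        ≡ leafPrefix W B p * select (B (inj₁ (suc p))) (transfer (start (B (inj₁ 0))))
    lastBlock-transfer n p B 2n≡p+3 fr@(leaves , beyond) =
      trans (cong (λ es → matchingSum B es (leafCount n)) (blockAt-next {n} (nextC-last {n} p+3≡2n)))
            (block-transfer B A Bv C (leafCount n) P (start (B C)) (beyond _ (n<1+n _)) none via-s C-taken via-r)
      where
      A Bv C : UVertex
      A = inj₁ (suc p)
      Bv = inj₁ (suc (suc p))
      C = inj₁ 0
      P : ℕ
      P = leafPrefix W B p
      p+3≡2n : suc (suc (suc p)) ≡ 2 * n
      p+3≡2n = sym (trans 2n≡p+3 (+-comm (suc p) 2))
      count : ∀ B′ → LeavesFree B′ → leafCount n B′
        ≡ leafChoices W (B′ C) * (leafPrefix W B′ p * leafChoices W (B′ A) * leafChoices W (B′ Bv))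
      count B′ = leafCount-prefix n (suc (suc p)) B′ (sym p+3≡2n)
      none : leafCount n B ≡ P * leafChoices W (B A) * W * leafChoices W (B C)
      none rewrite count B leaves | beyond _ (n<1+n (suc p)) = *-comm (leafChoices W (B C)) _
      via-s : B C ≡ false → leafCount n (B ⊕ (Bv , C)) ≡ P * leafChoices W (B A) * 1 * proj₂ (start (B C))
      via-s C-free rewrite count (B ⊕ (Bv , C)) (proj₁ (frontier-⊕ {B = B} ≤-refl z≤n fr))
        | ⊕-blocks₂ B Bv C | ⊕-blocks₁ B Bv C | C-free
        | ⊕-elsewhere B Bv C {A} (inj₁-≢ (n<1+n (suc p))) (λ ())
        | leafPrefix-⊕ B p (inj₂ (m<n⇒m<1+n (n<1+n p))) (inj₁ refl) = *-comm 1 _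
      C-taken : B C ≡ true → proj₂ (start (B C)) ≡ 0
      C-taken C-blocked rewrite C-blocked = refl
      via-r : B A ≡ false → leafCount n (B ⊕ (A , Bv)) ≡ P * 1 * 1 * leafChoices W (B C)
      via-r _ rewrite count (B ⊕ (A , Bv)) (proj₁ (frontier-⊕ {B = B} (n≤1+n _) ≤-refl fr))
        | ⊕-blocks₁ B A Bv | ⊕-blocks₂ B A Bv | ⊕-elsewhere B A Bv {C} (λ ()) (λ ())
        | leafPrefix-⊕ B p (inj₂ (n<1+n p)) (inj₂ (m<n⇒m<1+n (n<1+n p))) = *-comm (leafChoices W (B C)) _

    blocks-transfer : ∀ n k p B → 2 * n ≡ suc p + 2 * suc k → Frontier (suc p) B →
      matchingSum B (blocksFrom n (suc p) (suc k)) (leafCount n)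
        ≡ leafPrefix W B p * select (B (inj₁ (suc p))) (transfers (suc k) (start (B (inj₁ 0))))
    blocks-transfer n zero    p B 2n≡p+3 fr =
      trans (cong (λ es → matchingSum B es (leafCount n)) (++-identityʳ (blockAt n (suc p))))
            (lastBlock-transfer n p B 2n≡p+3 fr)
    blocks-transfer n (suc k) p B 2n≡p+2k+5 fr@(_ , beyond) =
      trans (matchingSum-++ B (blockAt n (suc p)) (blocksFrom n c (suc k)) (leafCount n))
     (trans (cong (λ es → matchingSum B es rest) (blockAt-next {n} (nextC-succ {n} c<2n)))
            (block-transfer B A Bv C rest P z (beyond _ (n<1+n _)) none via-s C-taken via-r))
      where
      c : ℕ
      c = suc (suc (suc p))
      A Bv C : UVertex
      A = inj₁ (suc p)
      Bv = inj₁ (suc (suc p))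
      C = inj₁ c
      P : ℕ
      P = leafPrefix W B p
      z : ℕ × ℕ
      z = transfers (suc k) (start (B (inj₁ 0)))
      2n≡c+2k+2 : 2 * n ≡ c + 2 * suc k
      2n≡c+2k+2 = trans 2n≡p+2k+5 (shift p k)
        where
        shift : ∀ p k → suc p + 2 * suc (suc k) ≡ suc (suc (suc p)) + 2 * suc k
        shift = solve-∀
      c<2n : c < 2 * n
      c<2n = subst (c <_) (sym 2n≡c+2k+2) (m<m+n c (s≤s z≤n))
      rest : Blocked → ℕ
      rest B′ = matchingSum B′ (blocksFrom n c (suc k)) (leafCount n)
      fr′ : Frontier c B
      fr′ = frontier-mono {B = B} (m≤n⇒m≤1+n (n≤1+n _)) fr
      C-free : B C ≡ false
      C-free = beyond c (m<n⇒m<1+n (n<1+n _))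
      none : rest B ≡ P * leafChoices W (B A) * W * proj₁ z
      none rewrite blocks-transfer n k (suc (suc p)) B 2n≡c+2k+2 fr′ | beyond _ (n<1+n (suc p)) | C-free = refl
      via-s : B C ≡ false → rest (B ⊕ (Bv , C)) ≡ P * leafChoices W (B A) * 1 * proj₂ z
      via-s _ rewrite blocks-transfer n k (suc (suc p)) (B ⊕ (Bv , C)) 2n≡c+2k+2
                        (frontier-⊕ {B = B} (n≤1+n _) ≤-refl fr′)
        | ⊕-blocks₁ B Bv C | ⊕-blocks₂ B Bv C
        | ⊕-elsewhere B Bv C {A} (inj₁-≢ (n<1+n _)) (inj₁-≢ (m<n⇒m<1+n (n<1+n _)))
        | ⊕-elsewhere B Bv C {inj₁ 0} (λ ()) (λ ())
        | leafPrefix-⊕ B p (inj₂ (m<n⇒m<1+n (n<1+n p))) (inj₂ (m<n⇒m<1+n (m<n⇒m<1+n (n<1+n p)))) = refl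
      C-taken : B C ≡ true → proj₂ z ≡ 0
      C-taken C-blocked = contradiction (trans (sym C-blocked) C-free) λ ()
      via-r : B A ≡ false → rest (B ⊕ (A , Bv)) ≡ P * 1 * 1 * proj₁ z
      via-r _ rewrite blocks-transfer n k (suc (suc p)) (B ⊕ (A , Bv)) 2n≡c+2k+2
                        (frontier-⊕ {B = B} (m≤n⇒m≤1+n (n≤1+n _)) (n≤1+n _) fr′)
        | ⊕-blocks₁ B A Bv | ⊕-blocks₂ B A Bv
        | ⊕-elsewhere B A Bv {C} (≢-sym (inj₁-≢ (m<n⇒m<1+n (n<1+n _)))) (≢-sym (inj₁-≢ (n<1+n _)))
        | ⊕-elsewhere B A Bv {inj₁ 0} (λ ()) (λ ())
        | leafPrefix-⊕ B p (inj₂ (n<1+n p)) (inj₂ (m<n⇒m<1+n (n<1+n p))) | C-free = refl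

    cycleCount : ℕ → ℕ
    cycleCount k = W * proj₁ (transfers k (start false)) + s * proj₂ (transfers k (start false))
                 + r * proj₁ (transfers k (start true))

    u≡matchingSum : ∀ n →
      u (suc n) m r s ≡ matchingSum unblocked (blocksFrom (suc n) 0 (suc n)) (leafCount (suc n))
    u≡matchingSum n = trans (hosoya≡matchingSum (U (suc n) m r s))
      (trans (matchingSum-++ unblocked (cycleEdges (suc n) r s) (leafEdges (suc n) m) (const 1))
             (cong (λ es → matchingSum unblocked es (leafCount (suc n))) (cycleEdges-blocks (suc n))))

    u≡cycleCount : ∀ k → u (suc k) m r s ≡ cycleCount k
    u≡cycleCount zero = begin
      u 1 m r s
        ≡⟨ u≡matchingSum 0 ⟩
      matchingSum unblocked (blockAt 1 0 ++ []) (leafCount 1)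
        ≡⟨ cong (λ es → matchingSum unblocked es (leafCount 1)) (++-identityʳ (blockAt 1 0)) ⟩
      matchingSum unblocked (blockAt 1 0) (leafCount 1)
        ≡⟨ matchingSum-path unblocked (inj₁ 0) (inj₁ 1) (inj₁ 0) r s (leafCount 1) ⟩
      leafCount 1 unblocked + s * leafCount 1 (unblocked ⊕ (inj₁ 1 , inj₁ 0))
        + r * leafCount 1 (unblocked ⊕ (inj₁ 0 , inj₁ 1))
        ≡⟨ cong₂ _+_ (cong₂ _+_ (count unblocked (λ _ → refl)) (cong (s *_) (count _ (λ _ → refl))))
                     (cong (r *_) (count _ (λ _ → refl))) ⟩
      W * (1 * W) + s * (1 * (1 * 1)) + r * (1 * (1 * 1))
        ≡⟨ one-block W r s ⟩
      cycleCount 0 ∎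
      where
      open ≡-Reasoning
      count : ∀ B → LeavesFree B → leafCount 1 B ≡ leafChoices W (B (inj₁ 0)) * leafPrefix W B 1
      count B = leafCount-prefix 1 1 B refl
      one-block : ∀ W r s → W * (1 * W) + s * (1 * (1 * 1)) + r * (1 * (1 * 1)) ≡ W * W + s * 1 + r * 1
      one-block = solve-∀
    u≡cycleCount (suc k) = begin
      u n m r s
        ≡⟨ u≡matchingSum (suc k) ⟩
      matchingSum unblocked (blockAt n 0 ++ blocksFrom n 2 (suc k)) (leafCount n)
        ≡⟨ matchingSum-++ unblocked (blockAt n 0) (blocksFrom n 2 (suc k)) (leafCount n) ⟩
      matchingSum unblocked (blockAt n 0) rest
        ≡⟨ cong (λ es → matchingSum unblocked es rest) (blockAt-next {n} (nextC-succ {n} 2<2n)) ⟩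
      matchingSum unblocked (replicate r (inj₁ 0 , inj₁ 1) ++ replicate s (inj₁ 1 , inj₁ 2)) rest
        ≡⟨ matchingSum-path unblocked (inj₁ 0) (inj₁ 1) (inj₁ 2) r s rest ⟩
      rest unblocked + s * rest (unblocked ⊕ (inj₁ 1 , inj₁ 2)) + r * rest (unblocked ⊕ (inj₁ 0 , inj₁ 1))
        ≡⟨ cong₂ _+_ (cong₂ _+_ (tail unblocked frontier₀)
                                (cong (s *_) (tail _ (frontier-⊕ {B = unblocked} (s≤s z≤n) ≤-refl frontier₀))))
                     (cong (r *_) (tail _ (frontier-⊕ {B = unblocked} z≤n (s≤s z≤n) frontier₀))) ⟩
      1 * W * proj₁ (transfers (suc k) (start false)) + s * (1 * 1 * proj₂ (transfers (suc k) (start false)))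
        + r * (1 * 1 * proj₁ (transfers (suc k) (start true)))
        ≡⟨ first-block W r s _ _ _ ⟩
      cycleCount (suc k) ∎
      where
      open ≡-Reasoning
      n : ℕ
      n = suc (suc k)
      2n≡2+2k+2 : 2 * n ≡ 2 + 2 * suc k
      2n≡2+2k+2 = *-suc 2 (suc k)
      2<2n : 2 < 2 * n
      2<2n = subst (2 <_) (sym 2n≡2+2k+2) (m<m+n 2 (s≤s z≤n))
      rest : Blocked → ℕ
      rest B = matchingSum B (blocksFrom n 2 (suc k)) (leafCount n)
      frontier₀ : Frontier 2 unblocked
      frontier₀ = (λ _ → refl) , (λ _ _ → refl)
      tail : ∀ B → Frontier 2 B →
        rest B ≡ leafPrefix W B 1 * select (B (inj₁ 2)) (transfers (suc k) (start (B (inj₁ 0))))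
      tail B = blocks-transfer n k 1 B 2n≡2+2k+2
      first-block : ∀ W r s x y z → 1 * W * x + s * (1 * 1 * y) + r * (1 * 1 * z) ≡ W * x + s * y + r * z
      first-block = solve-∀

    transfer-cayleyHamilton : ∀ b z →
      select b (transfer (transfer z)) + r * s * select b z ≡ M * select b (transfer z)
    transfer-cayleyHamilton false (z₀ , z₁) = cayleyHamilton₀ W r s z₀ z₁
      where
      cayleyHamilton₀ : ∀ W r s z₀ z₁ →
        (W * W + r) * ((W * W + r) * z₀ + s * W * z₁) + s * W * (W * z₀ + s * z₁) + r * s * z₀
          ≡ (W * W + r + s) * ((W * W + r) * z₀ + s * W * z₁)
      cayleyHamilton₀ = solve-∀
    transfer-cayleyHamilton true (z₀ , z₁) = cayleyHamilton₁ W r s z₀ z₁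
      where
      cayleyHamilton₁ : ∀ W r s z₀ z₁ →
        W * ((W * W + r) * z₀ + s * W * z₁) + s * (W * z₀ + s * z₁) + r * s * z₁
          ≡ (W * W + r + s) * (W * z₀ + s * z₁)
      cayleyHamilton₁ = solve-∀

    cycleCount-recurrence : ∀ k → cycleCount (2 + k) + r * s * cycleCount k ≡ M * cycleCount (1 + k)
    cycleCount-recurrence k = begin
      cycleCount (2 + k) + r * s * cycleCount k
        ≡⟨ regroup W r s (r * s) (proj₁ a₂) (proj₁ a₀) (proj₂ a₂) (proj₂ a₀) (proj₁ b₂) (proj₁ b₀) ⟩
      W * (proj₁ a₂ + r * s * proj₁ a₀) + s * (proj₂ a₂ + r * s * proj₂ a₀)
        + r * (proj₁ b₂ + r * s * proj₁ b₀)
        ≡⟨ cong₂ _+_ (cong₂ _+_ (cong (W *_) (transfer-cayleyHamilton false a₀))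
                                (cong (s *_) (transfer-cayleyHamilton true a₀)))
                     (cong (r *_) (transfer-cayleyHamilton false b₀)) ⟩
      W * (M * proj₁ a₁) + s * (M * proj₂ a₁) + r * (M * proj₁ b₁)
        ≡⟨ factor W r s M (proj₁ a₁) (proj₂ a₁) (proj₁ b₁) ⟩
      M * cycleCount (1 + k) ∎
      where
      open ≡-Reasoning
      a₀ = transfers k (start false)
      a₁ = transfer a₀
      a₂ = transfer a₁
      b₀ = transfers k (start true)
      b₁ = transfer b₀
      b₂ = transfer b₁
      regroup : ∀ W r s t x₂ x₀ y₂ y₀ z₂ z₀ →
        (W * x₂ + s * y₂ + r * z₂) + t * (W * x₀ + s * y₀ + r * z₀)
          ≡ W * (x₂ + t * x₀) + s * (y₂ + t * y₀) + r * (z₂ + t * z₀)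
      regroup = solve-∀
      factor : ∀ W r s M x y z → W * (M * x) + s * (M * y) + r * (M * z) ≡ M * (W * x + s * y + r * z)
      factor = solve-∀

    u-recurrence : ∀ k → u (2 + k) m r s + r * s * u k m r s ≡ M * u (1 + k) m r s
    u-recurrence zero rewrite u≡cycleCount 1 | u≡cycleCount 0 = two-blocks W r s
      where
      two-blocks : ∀ W r s →
        W * ((W * W + r) * W + s * W * 1) + s * (W * W + s * 1) + r * ((W * W + r) * 1 + s * W * 0) + r * s * 2
          ≡ (W * W + r + s) * (W * W + s * 1 + r * 1)
      two-blocks = solve-∀
    u-recurrence (suc k) rewrite u≡cycleCount (2 + k) | u≡cycleCount (1 + k) | u≡cycleCount k =
      cycleCount-recurrence k

    u-positive : ∀ k → 1 ≤ u k m r s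
    u-positive zero    = s≤s z≤n
    u-positive (suc k) rewrite hosoya≡matchingSum (U (suc k) m r s) = matchingSum-positive unblocked (U (suc k) m r s)

    u-one : u 1 m r s ≡ M
    u-one = trans (u≡cycleCount 0) (single-block W r s)
      where
      single-block : ∀ W r s → W * W + s * 1 + r * 1 ≡ W * W + r + s
      single-block = solve-∀

module LucasSequence where

  open import Data.Nat as ℕ using (zero)
  import Data.Nat.Properties as ℕ
  import Data.Integer as ℤ
  import Data.Integer.Properties as ℤ
  open import Data.Rational as ℚ using (ℚ; mkℚ; 1ℚ; _+_; _*_; _-_; -_; ½; 1/_; ≢-nonZero)
  open import Data.Rational.Properties
    using (normalize-coprime; *-assoc; *-identityʳ; *-inverseˡ; *-inverseʳ; *-zeroˡ; +-inverseʳ)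
  open import Data.Rational.Solver using (module +-*-Solver)
  open import Data.Nat.Coprimality using (1-coprimeTo) renaming (sym to coprime-sym)
  open import Data.Product using (proj₁; proj₂)
  open import Relation.Binary.PropositionalEquality
    using (_≢_; refl; sym; trans; cong; cong₂; subst; module ≡-Reasoning)
  open import Relation.Nullary using (yes; no; contradiction)

  open +-*-Solver

  ℕ→ℚ≡mkℚ : ∀ a → ℕ→ℚ a ≡ mkℚ (ℤ.+ a) 0 (coprime-sym (1-coprimeTo a))
  ℕ→ℚ≡mkℚ a = normalize-coprime (coprime-sym (1-coprimeTo a))

  ℕ→ℚ-+ : ∀ a b → ℕ→ℚ (a ℕ.+ b) ≡ ℕ→ℚ a + ℕ→ℚ b
  ℕ→ℚ-+ a b rewrite ℕ→ℚ≡mkℚ a | ℕ→ℚ≡mkℚ b =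
    cong (ℚ._/ 1) (sym (cong₂ ℤ._+_ (ℤ.*-identityʳ (ℤ.+ a)) (ℤ.*-identityʳ (ℤ.+ b))))

  ℕ→ℚ-* : ∀ a b → ℕ→ℚ (a ℕ.* b) ≡ ℕ→ℚ a * ℕ→ℚ b
  ℕ→ℚ-* a b rewrite ℕ→ℚ≡mkℚ a | ℕ→ℚ≡mkℚ b = cong (ℚ._/ 1) (ℤ.pos-* a b)

  ℕ→ℚ-suc≢0 : ∀ n → ℕ→ℚ (suc n) ≢ 0ℚ
  ℕ→ℚ-suc≢0 n eq with cong ℚ.numerator (trans (sym (ℕ→ℚ≡mkℚ (suc n))) eq)
  ... | ()

  ℕ→ℚ-recurrence : ∀ a b c M t → a ℕ.+ t ℕ.* b ≡ M ℕ.* c →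
    ℕ→ℚ a ≡ ℕ→ℚ M * ℕ→ℚ c - ℕ→ℚ t * ℕ→ℚ b
  ℕ→ℚ-recurrence a b c M t eq = begin
    ℕ→ℚ a                                 ≡⟨ cancel (ℕ→ℚ a) (ℕ→ℚ t * ℕ→ℚ b) ⟨
    ℕ→ℚ a + ℕ→ℚ t * ℕ→ℚ b - ℕ→ℚ t * ℕ→ℚ b ≡⟨ cong (_- ℕ→ℚ t * ℕ→ℚ b) ℕ→ℚ[a+tb] ⟨
    ℕ→ℚ (a ℕ.+ t ℕ.* b) - ℕ→ℚ t * ℕ→ℚ b   ≡⟨ cong (λ n → ℕ→ℚ n - ℕ→ℚ t * ℕ→ℚ b) eq ⟩
    ℕ→ℚ (M ℕ.* c) - ℕ→ℚ t * ℕ→ℚ b         ≡⟨ cong (_- ℕ→ℚ t * ℕ→ℚ b) (ℕ→ℚ-* M c) ⟩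
    ℕ→ℚ M * ℕ→ℚ c - ℕ→ℚ t * ℕ→ℚ b         ∎
    where
    open ≡-Reasoning
    ℕ→ℚ[a+tb] : ℕ→ℚ (a ℕ.+ t ℕ.* b) ≡ ℕ→ℚ a + ℕ→ℚ t * ℕ→ℚ b
    ℕ→ℚ[a+tb] = trans (ℕ→ℚ-+ a (t ℕ.* b)) (cong (ℕ→ℚ a +_) (ℕ→ℚ-* t b))
    cancel : ∀ x y → x + y - y ≡ x
    cancel = solve 2 (λ x y → x :+ y :- y := x) refl

  /ℚ-*-cancel : ∀ p q → q ≢ 0ℚ → (p /ℚ q) * q ≡ p
  /ℚ-*-cancel p q q≢0 with q ℚ.≟ 0ℚ
  ... | yes q≡0 = contradiction q≡0 q≢0
  ... | no _ = trans (*-assoc p (1/_ q {{≢-nonZero q≢0}}) q)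
                     (trans (cong (p *_) (*-inverseˡ q {{≢-nonZero q≢0}})) (*-identityʳ p))

  /ℚ-unique : ∀ p q y → q ≢ 0ℚ → y * q ≡ p → p /ℚ q ≡ y
  /ℚ-unique p q y q≢0 refl with q ℚ.≟ 0ℚ
  ... | yes q≡0 = contradiction q≡0 q≢0
  ... | no _ = trans (*-assoc y q (1/_ q {{≢-nonZero q≢0}}))
                     (trans (cong (y *_) (*-inverseʳ q {{≢-nonZero q≢0}})) (*-identityʳ y))

  module SecondOrder (M R : ℚ) where

    Recurrence : (ℕ → ℚ) → Set
    Recurrence t = ∀ k → t (2 ℕ.+ k) ≡ M * t (1 ℕ.+ k) - R * t k

    recurrence-unique : ∀ f g → Recurrence f → Recurrence g → f 0 ≡ g 0 → f 1 ≡ g 1 →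
      ∀ n → f n ≡ g n
    recurrence-unique f g f-rec g-rec f₀ f₁ n = proj₁ (both n)
      where
      both : ∀ n → f n ≡ g n × f (suc n) ≡ g (suc n)
      both zero    = f₀ , f₁
      both (suc n) = let fn , fn+1 = both n in
        fn+1 , trans (f-rec n) (trans (cong₂ (λ a b → M * a - R * b) fn+1 fn) (sym (g-rec n)))

    -- α and β are the roots (M ± √D)/2 of X² - M X + R
    module PowerSums (D : ℚ) (D≡M²-4R : D ≡ M * M - ℕ→ℚ 4 * R) where

      open QuadExt D

      α β : Q√
      α = (M * ½ , ½)
      β = (M * ½ , - ½)

      β^≡conj-α^ : ∀ k → β ^√ k ≡ (proj₁ (α ^√ k) , - proj₂ (α ^√ k))
      β^≡conj-α^ zero    = refl
      β^≡conj-α^ (suc k) rewrite β^≡conj-α^ k = cong₂ _,_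
        (conj₁ M D (proj₁ (α ^√ k)) (proj₂ (α ^√ k)))
        (conj₂ M (proj₁ (α ^√ k)) (proj₂ (α ^√ k)))
        where
        conj₁ : ∀ M D a b → M * ½ * a + (- ½) * (- b) * D ≡ M * ½ * a + ½ * b * D
        conj₁ = solve 4 (λ M D a b → M :* con ½ :* a :+ (:- con ½) :* (:- b) :* D
                                    := M :* con ½ :* a :+ con ½ :* b :* D) refl
        conj₂ : ∀ M a b → M * ½ * (- b) + (- ½) * a ≡ - (M * ½ * b + ½ * a)
        conj₂ = solve 3 (λ M a b → M :* con ½ :* (:- b) :+ (:- con ½) :* a
                                  := :- (M :* con ½ :* b :+ con ½ :* a)) refl

      powerSum : ℕ → ℚ
      powerSum k = proj₁ (α ^√ k) + proj₁ (α ^√ k)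

      powerSum-recurrence : Recurrence powerSum
      powerSum-recurrence k =
        subst (λ D′ → Step M R D′ (proj₁ (α ^√ k)) (proj₂ (α ^√ k))) (sym D≡M²-4R) (root M R _ _)
        where
        Step : ℚ → ℚ → ℚ → ℚ → ℚ → Set
        Step M R D a b = p + p ≡ M * (q + q) - R * (a + a)
          where
          q = M * ½ * a + ½ * b * D
          p = M * ½ * q + ½ * (M * ½ * b + ½ * a) * D
        root : ∀ M R a b → Step M R (M * M - ℕ→ℚ 4 * R) a b
        root = solve 4 (λ M R a b →
          let D = M :* M :- con (ℕ→ℚ 4) :* R
              q = M :* con ½ :* a :+ con ½ :* b :* D
              p = M :* con ½ :* q :+ con ½ :* (M :* con ½ :* b :+ con ½ :* a) :* D
          in p :+ p := M :* (q :+ q) :- R :* (a :+ a)) refl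

      α^+β^≡powerSum : ∀ k → (α ^√ k) +√ (β ^√ k) ≡ (powerSum k , 0ℚ)
      α^+β^≡powerSum k = trans (cong ((α ^√ k) +√_) (β^≡conj-α^ k))
                               (cong (powerSum k ,_) (+-inverseʳ (proj₂ (α ^√ k))))

      α^+β^≡solution : ∀ t → Recurrence t → t 0 ≡ ℕ→ℚ 2 → t 1 ≡ M →
        ∀ n → (α ^√ n) +√ (β ^√ n) ≡ (t n , 0ℚ)
      α^+β^≡solution t t-rec t₀ t₁ n = trans (α^+β^≡powerSum n)
        (cong (_, 0ℚ) (recurrence-unique powerSum t powerSum-recurrence t-rec (sym t₀)
                                         (trans (powerSum₁ M D) (sym t₁)) n))
        where
        powerSum₁ : ∀ M D → M * ½ * 1ℚ + ½ * 0ℚ * D + (M * ½ * 1ℚ + ½ * 0ℚ * D) ≡ M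
        powerSum₁ = solve 2 (λ M D → M :* con ½ :* con 1ℚ :+ con ½ :* con 0ℚ :* D
                                    :+ (M :* con ½ :* con 1ℚ :+ con ½ :* con 0ℚ :* D) := M) refl

  module NaturalSolution (m r s : ℕ) (a : ℕ → ℕ)
    (a-recurrence : ∀ k →
       a (2 ℕ.+ k) ℕ.+ r ℕ.* s ℕ.* a k ≡ (suc m ℕ.* suc m ℕ.+ r ℕ.+ s) ℕ.* a (1 ℕ.+ k))
    (a₀ : a 0 ≡ 2) (a₁ : a 1 ≡ suc m ℕ.* suc m ℕ.+ r ℕ.+ s) (a-positive : ∀ k → 1 ℕ.≤ a k) where

    M R : ℚ
    M = Mval m r s
    R = ℕ→ℚ (r ℕ.* s)

    open SecondOrder M R

    t : ℕ → ℚ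
    t k = ℕ→ℚ (a k)

    t-recurrence : Recurrence t
    t-recurrence k = ℕ→ℚ-recurrence (a (2 ℕ.+ k)) (a k) (a (1 ℕ.+ k))
      (suc m ℕ.* suc m ℕ.+ r ℕ.+ s) (r ℕ.* s) (a-recurrence k)

    t≢0 : ∀ k → t k ≢ 0ℚ
    t≢0 k with a k | a-positive k
    ... | suc n | _ = ℕ→ℚ-suc≢0 n

    ratio : ∀ k → t (suc k) /ℚ t k ≡ x k m r s
    ratio zero = /ℚ-unique (t 1) (t 0) (M - M /ℚ ℕ→ℚ 2) (t≢0 0) (begin
      (M - M /ℚ ℕ→ℚ 2) * t 0               ≡⟨ cong ((M - M /ℚ ℕ→ℚ 2) *_) (cong ℕ→ℚ a₀) ⟩
      (M - M /ℚ ℕ→ℚ 2) * ℕ→ℚ 2             ≡⟨ distrib M (M /ℚ ℕ→ℚ 2) (ℕ→ℚ 2) ⟩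
      M * ℕ→ℚ 2 - (M /ℚ ℕ→ℚ 2) * ℕ→ℚ 2     ≡⟨ cong (λ y → M * ℕ→ℚ 2 - y) (/ℚ-*-cancel M _ (ℕ→ℚ-suc≢0 1)) ⟩
      M * ℕ→ℚ 2 - M                        ≡⟨ twice M ⟩
      M                                    ≡⟨ cong ℕ→ℚ a₁ ⟨
      t 1 ∎)
      where
      open ≡-Reasoning
      distrib : ∀ a b c → (a - b) * c ≡ a * c - b * c
      distrib = solve 3 (λ a b c → (a :- b) :* c := a :* c :- b :* c) refl
      twice : ∀ a → a * ℕ→ℚ 2 - a ≡ a
      twice = solve 1 (λ a → a :* con (ℕ→ℚ 2) :- a := a) refl
    ratio (suc k) = /ℚ-unique (t (2 ℕ.+ k)) (t (suc k)) (M - R /ℚ xₖ) (t≢0 (suc k)) (begin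
      (M - R /ℚ xₖ) * t (suc k)               ≡⟨ distrib M (R /ℚ xₖ) (t (suc k)) ⟩
      M * t (suc k) - (R /ℚ xₖ) * t (suc k)   ≡⟨ cong (λ y → M * t (suc k) - y) quotient ⟩
      M * t (suc k) - R * t k                 ≡⟨ t-recurrence k ⟨
      t (2 ℕ.+ k) ∎)
      where
      open ≡-Reasoning
      xₖ : ℚ
      xₖ = x k m r s
      distrib : ∀ a b c → (a - b) * c ≡ a * c - b * c
      distrib = solve 3 (λ a b c → (a :- b) :* c := a :* c :- b :* c) refl
      xₖ*tₖ : xₖ * t k ≡ t (suc k)
      xₖ*tₖ = trans (cong (_* t k) (sym (ratio k))) (/ℚ-*-cancel (t (suc k)) (t k) (t≢0 k))
      xₖ≢0 : xₖ ≢ 0ℚ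
      xₖ≢0 xₖ≡0 = t≢0 (suc k) (trans (sym xₖ*tₖ) (trans (cong (_* t k) xₖ≡0) (*-zeroˡ (t k))))
      quotient : (R /ℚ xₖ) * t (suc k) ≡ R * t k
      quotient = begin
        (R /ℚ xₖ) * t (suc k)    ≡⟨ cong ((R /ℚ xₖ) *_) xₖ*tₖ ⟨
        (R /ℚ xₖ) * (xₖ * t k)   ≡⟨ *-assoc (R /ℚ xₖ) xₖ (t k) ⟨
        (R /ℚ xₖ) * xₖ * t k     ≡⟨ cong (_* t k) (/ℚ-*-cancel R xₖ xₖ≢0) ⟩
        R * t k ∎

    closedForm≡ : ∀ n → closedForm n m r s ≡ (t n , 0ℚ)
    closedForm≡ = α^+β^≡solution t t-recurrence (cong ℕ→ℚ a₀) (cong ℕ→ℚ a₁)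
      where
      open PowerSums (M * M - ℕ→ℚ (4 ℕ.* r ℕ.* s))
        (cong (λ y → M * M - y) (trans (cong ℕ→ℚ (ℕ.*-assoc 4 r s)) (ℕ→ℚ-* 4 (r ℕ.* s))))

open MatchingCount using (module HosoyaU)
open LucasSequence using (module NaturalSolution)

theorem1 : (n m r s : ℕ) → 1 ≤ n → 1 ≤ r → 1 ≤ s →
    (ℕ→ℚ (u n m r s) /ℚ ℕ→ℚ (u (n ∸ 1) m r s) ≡ x (n ∸ 1) m r s)
    × (closedForm n m r s ≡ (ℕ→ℚ (u n m r s) , 0ℚ))
theorem1 (suc k) m r s _ _ _ = ratio k , closedForm≡ (suc k)
  where
  open HosoyaU m r s
  open NaturalSolution m r s (λ k → u k m r s) u-recurrence refl u-one u-positive
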